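{- Let $G$ be a finite, simple, connected graph with at least one edge, on vertex set $\{1,\dots,N\}$, let $\nabla_G=\{\pm(\mathbf e_i-\mathbf e_j)\mid \{i,j\}\in\mathcal E(G)\}\subset\mathbb R^N$, and let $B$ be a maximal bipartite subgraph of $G$ with bipartition of its vertices $\mathcal V(B)=V_+\cup V_-$. Then the set $$F=\{\mathbf e_i-\mathbf e_j\mid \{i,j\}\in\mathcal E(B),\ i\in V_-,\ j\in V_+\}$$ is a facet of $\nabla_G$, with inner normal $\boldsymbol\alpha=(\alpha_1,\dots,\alpha_N)^\top$ given by $\alpha_i=+1/2$ if $i\in V_+$ and $\alpha_i=-1/2$ if $i\in V_-$, and the digraph $\vec B$ on $\mathcal V(B)$ with edge set $\{(i,j)\mid \{i,j\}\in\mathcal E(B),\ i\in V_-,\ j\in V_+\}$ is its associated directed facet subgraph $\vec G_F$.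
   Context: $\mathbf e_1,\dots,\mathbf e_N$ is the standard basis of $\mathbb R^N$. A subset $F\subseteq\nabla_G$ is a facet of $\nabla_G$ if $F=\nabla_G\cap P'$ for a facet $P'$ of the polytope $\operatorname{conv}(\nabla_G)$; an inner normal of $F$ is a vector $\boldsymbol\alpha$ such that $F$ is exactly the set of points of $\nabla_G$ minimizing $\langle\cdot,\boldsymbol\alpha\rangle$ over $\nabla_G$. For nonempty $X\subseteq\nabla_G$, $\vec G_X$ is the directed graph with edge set $\{(i,j)\mid \mathbf e_i-\mathbf e_j\in X\}$ and vertex set the endpoints of these edges. A maximal bipartite subgraph of $G$ is a bipartite subgraph maximal under inclusion (it is necessarily spanning and connected). -}

module Defs where

open import Level using (0ℓ)
open import Data.Nat using (ℕ; zero; suc)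
open import Data.Fin using (Fin; zero; suc; _≟_)
open import Data.Bool using (Bool; true; false; T; if_then_else_)
open import Data.Rational using (ℚ; 0ℚ; 1ℚ; ½; -½; _+_; _-_; _*_; _≤_)
open import Data.Product using (Σ; ∃; _×_; _,_)
open import Data.Empty using (⊥)
open import Data.Sum using (_⊎_)
open import Relation.Nullary using (¬_; yes; no)
open import Relation.Binary.PropositionalEquality using (_≡_; _≢_)
open import Function.Bundles using (_⇔_)

Pt : ℕ → Set
Pt N = Fin N → ℚ

_≋_ : ∀ {N} → Pt N → Pt N → Set
x ≋ y = ∀ k → x k ≡ y k

PtSet : ℕ → Set₁
PtSet N = Pt N → Set

e : ∀ {N} → Fin N → Pt N
e i k with i ≟ k
... | yes _ = 1ℚ
... | no  _ = 0ℚ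

_⊖_ : ∀ {N} → Pt N → Pt N → Pt N
(x ⊖ y) k = x k - y k

Σℚ : ∀ {n} → (Fin n → ℚ) → ℚ
Σℚ {zero}  f = 0ℚ
Σℚ {suc n} f = f zero + Σℚ (λ i → f (suc i))

⟨_,_⟩ : ∀ {N} → Pt N → Pt N → ℚ
⟨ x , a ⟩ = Σℚ (λ k → x k * a k)

-- Faces / facets of a finite point set S (faces of conv S intersected with S)

IsInnerNormal : ∀ {N} → PtSet N → PtSet N → Pt N → Set
IsInnerNormal S X α =
  ∀ x → X x ⇔ (S x × (∀ y → S y → ⟨ x , α ⟩ ≤ ⟨ y , α ⟩))

AffIndep : ∀ {N k} → (Fin k → Pt N) → Set
AffIndep {N} {k} p =
  (c : Fin k → ℚ) → Σℚ c ≡ 0ℚ → (∀ m → Σℚ (λ i → c i * p i m) ≡ 0ℚ) →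
  ∀ i → c i ≡ 0ℚ

AffDim : ∀ {N} → PtSet N → ℕ → Set
AffDim {N} X d =
  (Σ (Fin (suc d) → Pt N) λ p → (∀ i → X (p i)) × AffIndep p) ×
  ((p : Fin (suc (suc d)) → Pt N) → (∀ i → X (p i)) → ¬ AffIndep p)

-- X = S ∩ P' for a facet P' of conv S : X is the minimizer set of a linear
-- functional over S (so conv X is a face of conv S, of dimension dim aff X),
-- and dim aff X = dim aff S - 1.
IsFacet : ∀ {N} → PtSet N → PtSet N → Set
IsFacet {N} S X =
  (Σ (Pt N) λ α → IsInnerNormal S X α) ×
  (Σ ℕ λ d → AffDim S (suc d) × AffDim X d)

IsSimpleGraph : ∀ {N} → (Fin N → Fin N → Bool) → Set
IsSimpleGraph E = (∀ i j → T (E i j) → T (E j i)) × (∀ i → ¬ T (E i i))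

data Walk {N} (E : Fin N → Fin N → Bool) : Fin N → Fin N → Set where
  here : ∀ {i} → Walk E i i
  step : ∀ {i k j} → T (E i k) → Walk E k j → Walk E i j

Connected : ∀ {N} → (Fin N → Fin N → Bool) → Set
Connected E = ∀ i j → Walk E i j

HasEdge : ∀ {N} → (Fin N → Fin N → Bool) → Set
HasEdge E = ∃ λ i → ∃ λ j → T (E i j)

record Subgraph {N} (E : Fin N → Fin N → Bool) : Set where
  field
    V    : Fin N → Bool
    H    : Fin N → Fin N → Bool
    Hsym : ∀ i j → T (H i j) → T (H j i)
    H⊆E  : ∀ i j → T (H i j) → T (E i j)
    ends : ∀ i j → T (H i j) → T (V i) × T (V j)
open Subgraph public

IsBipartition : ∀ {N} {E : Fin N → Fin N → Bool} → Subgraph E → (Fin N → Bool) → Set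
IsBipartition B side = ∀ i j → T (H B i j) → side i ≢ side j

Bipartite : ∀ {N} {E : Fin N → Fin N → Bool} → Subgraph E → Set
Bipartite {N} B = Σ (Fin N → Bool) λ c → IsBipartition B c

_≤G_ : ∀ {N} {E : Fin N → Fin N → Bool} → Subgraph E → Subgraph E → Set
B ≤G B' = (∀ i → T (V B i) → T (V B' i)) × (∀ i j → T (H B i j) → T (H B' i j))

MaximalBipartite : ∀ {N} {E : Fin N → Fin N → Bool} → Subgraph E → Set
MaximalBipartite {E = E} B =
  Bipartite B × ((B' : Subgraph E) → Bipartite B' → B ≤G B' → B' ≤G B)

Nabla : ∀ {N} → (Fin N → Fin N → Bool) → PtSet N
Nabla E x = ∃ λ i → ∃ λ j → T (E i j) × (x ≋ (e i ⊖ e j) ⊎ x ≋ (e j ⊖ e i))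

-- the candidate facet F, with side i ≡ true meaning i ∈ V₊, false meaning i ∈ V₋
FacetOf : ∀ {N} {E : Fin N → Fin N → Bool} → Subgraph E → (Fin N → Bool) → PtSet N
FacetOf B side x =
  ∃ λ i → ∃ λ j → T (H B i j) × side i ≡ false × side j ≡ true × x ≋ (e i ⊖ e j)

normalOf : ∀ {N} → (Fin N → Bool) → Pt N
normalOf side i = if side i then ½ else -½

DiEdge : ∀ {N} → PtSet N → Fin N → Fin N → Set
DiEdge X i j = X (e i ⊖ e j)

DiVertex : ∀ {N} → PtSet N → Fin N → Set
DiVertex X i = ∃ λ j → DiEdge X i j ⊎ DiEdge X j i

{-# OPTIONS --safe #-}
-- The functional α = ½ (1_{V₊} − 1_{V₋}) takes the values −1, 0, 1 on ∇_G, and −1 exactly on the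
-- arrows e_i − e_j of edges of G with i ∈ V₋, j ∈ V₊.  Such an edge can be added to B without
-- destroying bipartiteness, so by maximality it already is an edge of B; hence F is the set of
-- minimisers of α.  Maximality also makes B spanning and connected: if a vertex set S were closed
-- under B-edges, flip the colours outside S; any edge of G leaving S could then be added to B.
-- The arrows along a breadth-first spanning tree of B are linearly independent (the system is
-- triangular with respect to depth), giving N − 1 affinely independent points of F and, together
-- with one reversed arrow, N points of ∇_G.  Conversely ∇_G lies in the hyperplane Σ x = 0 and F
-- moreover in ⟨ x , α ⟩ = −1, so by Gaussian elimination any further point is affinely dependent.

module Submission where

open import Defs
open import Data.Nat using (ℕ)
open import Data.Fin using (Fin)
open import Data.Bool using (Bool; true; false; T)
open import Data.Bool as Bool using (_∨_; not; if_then_else_)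
open import Data.Bool.Properties using (T-∨; T-≡; not-injective; not-¬)
open import Data.Product using (_×_)
open import Relation.Binary.PropositionalEquality using (_≡_)
open import Function.Bundles using (_⇔_)

open import Algebra.Bundles using (CommutativeRing)
open import Data.Nat using (zero; suc; _<_; _≤_; _∸_; s≤s)
open import Data.Nat.Properties
  using (≤-refl; ≤-reflexive; ≤-trans; m<n⇒m<1+n; <-≤-trans; n≮n; ≮⇒≥; ∸-monoʳ-<)
open import Data.Fin using (zero; suc; punchIn; _≟_)
open import Data.Fin.Properties using (any?; all?; ¬∀⟶∃¬; suc-injective; punchInᵢ≢i)
open import Data.Product as Product using (Σ; ∃; _,_; proj₁; proj₂)
open import Data.Sum as Sum using (_⊎_; inj₁; inj₂)
open import Data.Rational using (ℚ; 0ℚ; 1ℚ; _+_; _-_; _*_; -_; 1/_; ≢-nonZero)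
  renaming (_≤_ to _≤ℚ_)
open import Data.Rational.Properties as ℚ using (1≢0)
open import Data.Rational.Solver using (module +-*-Solver)
open import Data.Vec.Functional using (_∷_; insertAt)
open import Data.Vec.Functional.Properties using (insertAt-lookup; insertAt-punchIn)
open import Function.Base using (_∘_)
open import Relation.Binary.PropositionalEquality using (_≢_; refl; sym; trans; cong; cong₂; subst; module ≡-Reasoning)
open import Relation.Nullary using (¬_; Dec; does; yes; no; ¬?; contradiction; _×-dec_; _⊎-dec_; T?)
open import Relation.Unary using (Decidable)
open import Relation.Nullary.Decidable using (decidable-stable; dec-true; toWitness; toWitnessFalse)
open import Data.Fin.Subset using (Subset; _∈_; _∉_; ⁅_⁆; ∣_∣; _⊆_; _⊂_; Nonempty)
open import Data.Fin.Subset.Properties using (_∈?_; x∈⁅x⁆; x∈⁅y⁆⇒x≡y; ∣⁅x⁆∣≡1; ∣p∣≤n; p⊂q⇒∣p∣<∣q∣)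
open import Data.Vec using (tabulate)
open import Data.Vec.Properties using (lookup∘tabulate; []=⇒lookup; lookup⇒[]=)
open import Function.Bundles using (mk⇔; Equivalence)
import Algebra.Properties.Semiring.Sum as SemiringSum
import Algebra.Properties.Group as GroupProperties

open +-*-Solver
open ≡-Reasoning

module ∑ = SemiringSum (CommutativeRing.semiring ℚ.+-*-commutativeRing)
module ℚ-Group = GroupProperties ℚ.+-0-group

Σℚ≡sum : ∀ {n} (f : Fin n → ℚ) → Σℚ f ≡ ∑.sum f
Σℚ≡sum {zero}  f = refl
Σℚ≡sum {suc n} f = cong (f zero +_) (Σℚ≡sum (f ∘ suc))

Σℚ-cong : ∀ {n} {f g : Fin n → ℚ} → (∀ i → f i ≡ g i) → Σℚ f ≡ Σℚ g
Σℚ-cong {f = f} {g} f≗g rewrite Σℚ≡sum f | Σℚ≡sum g = ∑.sum-cong-≗ f≗g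

Σℚ-zero : ∀ {n} {f : Fin n → ℚ} → (∀ i → f i ≡ 0ℚ) → Σℚ f ≡ 0ℚ
Σℚ-zero {n} f≗0 = trans (Σℚ-cong f≗0) (trans (Σℚ≡sum {n} (λ _ → 0ℚ)) (∑.sum-replicate-zero n))

Σℚ-distrib-+ : ∀ {n} (f g : Fin n → ℚ) → Σℚ (λ i → f i + g i) ≡ Σℚ f + Σℚ g
Σℚ-distrib-+ f g rewrite Σℚ≡sum (λ i → f i + g i) | Σℚ≡sum f | Σℚ≡sum g = ∑.∑-distrib-+ f g

*-distribˡ-Σℚ : ∀ {n} a (f : Fin n → ℚ) → a * Σℚ f ≡ Σℚ (λ i → a * f i)
*-distribˡ-Σℚ a f rewrite Σℚ≡sum f | Σℚ≡sum (λ i → a * f i) = ∑.*-distribˡ-sum a f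

*-distribʳ-Σℚ : ∀ {n} a (f : Fin n → ℚ) → Σℚ f * a ≡ Σℚ (λ i → f i * a)
*-distribʳ-Σℚ a f rewrite Σℚ≡sum f | Σℚ≡sum (λ i → f i * a) = ∑.*-distribʳ-sum a f

Σℚ-comm : ∀ {m n} (f : Fin m → Fin n → ℚ) →
  Σℚ (λ i → Σℚ (λ j → f i j)) ≡ Σℚ (λ j → Σℚ (λ i → f i j))
Σℚ-comm f = begin
  Σℚ (λ i → Σℚ (f i))                 ≡⟨ Σℚ-cong (λ i → Σℚ≡sum (f i)) ⟩
  Σℚ (λ i → ∑.sum (f i))              ≡⟨ Σℚ≡sum (λ i → ∑.sum (f i)) ⟩
  ∑.sum (λ i → ∑.sum (f i))           ≡⟨ ∑.∑-comm f ⟩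
  ∑.sum (λ j → ∑.sum (λ i → f i j))   ≡⟨ Σℚ≡sum (λ j → ∑.sum (λ i → f i j)) ⟨
  Σℚ (λ j → ∑.sum (λ i → f i j))      ≡⟨ Σℚ-cong (λ j → Σℚ≡sum (λ i → f i j)) ⟨
  Σℚ (λ j → Σℚ (λ i → f i j))         ∎

Σℚ-remove : ∀ {n} (f : Fin (suc n) → ℚ) k → Σℚ f ≡ f k + Σℚ (f ∘ punchIn k)
Σℚ-remove f k rewrite Σℚ≡sum f | Σℚ≡sum (f ∘ punchIn k) = ∑.sum-remove f

Σℚ-single : ∀ {n} (f : Fin n → ℚ) k → (∀ i → i ≢ k → f i ≡ 0ℚ) → Σℚ f ≡ f k
Σℚ-single {suc _} f k others≡0 = begin
  Σℚ f                          ≡⟨ Σℚ-remove f k ⟩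
  f k + Σℚ (f ∘ punchIn k)      ≡⟨ cong (f k +_) (Σℚ-zero (λ i → others≡0 _ (punchInᵢ≢i k i))) ⟩
  f k + 0ℚ                      ≡⟨ ℚ.+-identityʳ (f k) ⟩
  f k                           ∎

Σℚ-linear : ∀ {n} a b (f g : Fin n → ℚ) →
  Σℚ (λ i → a * f i + b * g i) ≡ a * Σℚ f + b * Σℚ g
Σℚ-linear a b f g = begin
  Σℚ (λ i → a * f i + b * g i)            ≡⟨ Σℚ-distrib-+ (λ i → a * f i) (λ i → b * g i) ⟩
  Σℚ (λ i → a * f i) + Σℚ (λ i → b * g i) ≡⟨ cong₂ _+_ (*-distribˡ-Σℚ a f) (*-distribˡ-Σℚ b g) ⟨
  a * Σℚ f + b * Σℚ g                     ∎

x*y≡0⇒x≡0 : ∀ {x y} → y ≢ 0ℚ → x * y ≡ 0ℚ → x ≡ 0ℚ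
x*y≡0⇒x≡0 {x} {y} y≢0 xy≡0 = begin
  x               ≡⟨ ℚ.*-identityʳ x ⟨
  x * 1ℚ          ≡⟨ cong (x *_) (ℚ.*-inverseʳ y) ⟨
  x * (y * 1/ y)  ≡⟨ ℚ.*-assoc x y (1/ y) ⟨
  x * y * 1/ y    ≡⟨ cong (_* 1/ y) xy≡0 ⟩
  0ℚ * 1/ y       ≡⟨ ℚ.*-zeroˡ (1/ y) ⟩
  0ℚ              ∎
  where instance _ = ≢-nonZero y≢0

lincomb : ∀ {m N} → (Fin m → ℚ) → (Fin m → Pt N) → Pt N
lincomb c p k = Σℚ (λ i → c i * p i k)

LinDep : ∀ {m N} → (Fin m → Pt N) → Set
LinDep {m} p = Σ (Fin m → ℚ) λ c → (∃ λ i → c i ≢ 0ℚ) × (∀ k → lincomb c p k ≡ 0ℚ)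

LinIndep : ∀ {m N} → (Fin m → Pt N) → Set
LinIndep {m} p = (c : Fin m → ℚ) → (∀ k → lincomb c p k ≡ 0ℚ) → ∀ i → c i ≡ 0ℚ

-- One step of fraction-free Gaussian elimination on the first coordinate, with pivot row k.
pivotReduce : ∀ {m n} → (Fin (suc m) → Pt (suc n)) → Fin (suc m) → Fin m → Pt n
pivotReduce v k i r = v k zero * v (punchIn k i) (suc r) - v (punchIn k i) zero * v k (suc r)

linDep-pivot : ∀ {m n} (v : Fin (suc m) → Pt (suc n)) k → v k zero ≢ 0ℚ →
  LinDep (pivotReduce v k) → LinDep v
linDep-pivot {m} {n} v k a≢0 (d , (j , dⱼ≢0) , d-rel) = c , (punchIn k j , cⱼ≢0) , c-rel
  where
  a : ℚ
  a = v k zero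
  x : Fin m → Pt (suc n)
  x i = v (punchIn k i)
  S : ℚ
  S = Σℚ (λ i → d i * x i zero)
  c : Fin (suc m) → ℚ
  c = insertAt (λ i → a * d i) k (- S)

  cⱼ≢0 : c (punchIn k j) ≢ 0ℚ
  cⱼ≢0 cⱼ≡0 = dⱼ≢0 (x*y≡0⇒x≡0 a≢0 (begin
    d j * a                ≡⟨ ℚ.*-comm (d j) a ⟩
    a * d j                ≡⟨ insertAt-punchIn _ k (- S) j ⟨
    c (punchIn k j)        ≡⟨ cⱼ≡0 ⟩
    0ℚ                     ∎))

  split : ∀ r → lincomb c v r ≡ - S * v k r + a * Σℚ (λ i → d i * x i r)
  split r = begin
    lincomb c v r                                        ≡⟨ Σℚ-remove (λ i → c i * v i r) k ⟩
    c k * v k r + Σℚ (λ i → c (punchIn k i) * x i r)    ≡⟨ cong₂ _+_ (cong (_* v k r) (insertAt-lookup _ k (- S)))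
                                                              (Σℚ-cong other) ⟩
    - S * v k r + Σℚ (λ i → a * (d i * x i r))           ≡⟨ cong (- S * v k r +_) (*-distribˡ-Σℚ a (λ i → d i * x i r)) ⟨
    - S * v k r + a * Σℚ (λ i → d i * x i r)             ∎
    where
    other : ∀ i → c (punchIn k i) * x i r ≡ a * (d i * x i r)
    other i = trans (cong (_* x i r) (insertAt-punchIn _ k (- S) i)) (ℚ.*-assoc a (d i) (x i r))

  c-rel : ∀ r → lincomb c v r ≡ 0ℚ
  c-rel zero = begin
    lincomb c v zero  ≡⟨ split zero ⟩
    - S * a + a * S   ≡⟨ solve 2 (λ S a → (:- S) :* a :+ a :* S := con 0ℚ) refl S a ⟩
    0ℚ                ∎
  c-rel (suc r) = begin
    lincomb c v (suc r)                    ≡⟨ split (suc r) ⟩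
    - S * b + a * Y                        ≡⟨ solve 4 (λ S b a Y → (:- S) :* b :+ a :* Y := a :* Y :+ (:- b) :* S)
                                                    refl S b a Y ⟩
    a * Y + - b * S                        ≡⟨ Σℚ-linear a (- b) (λ i → d i * x i (suc r)) (λ i → d i * x i zero) ⟨
    Σℚ (λ i → a * (d i * x i (suc r)) + - b * (d i * x i zero))
                                           ≡⟨ Σℚ-cong term ⟩
    lincomb d (pivotReduce v k) r          ≡⟨ d-rel r ⟩
    0ℚ                                     ∎
    where
    b : ℚ
    b = v k (suc r)
    Y : ℚ
    Y = Σℚ (λ i → d i * x i (suc r))
    term : ∀ i → a * (d i * x i (suc r)) + - b * (d i * x i zero) ≡ d i * pivotReduce v k i r
    term i = solve 5 (λ a b dᵢ y z → a :* (dᵢ :* y) :+ (:- b) :* (dᵢ :* z) := dᵢ :* (a :* y :- z :* b))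
                     refl a b (d i) (x i (suc r)) (x i zero)

linDep-zeroColumn : ∀ {m n} (v : Fin m → Pt (suc n)) → (∀ i → v i zero ≡ 0ℚ) →
  LinDep (λ i → v i ∘ suc) → LinDep v
linDep-zeroColumn v column≡0 (c , nontrivial , rel) = c , nontrivial , λ where
  zero    → Σℚ-zero (λ i → trans (cong (c i *_) (column≡0 i)) (ℚ.*-zeroʳ (c i)))
  (suc r) → rel r

linDep : ∀ {m n} → n < m → (v : Fin m → Pt n) → LinDep v
linDep {n = zero}  (s≤s _)   v = (λ _ → 1ℚ) , (zero , 1≢0) , λ ()
linDep {n = suc n} (s≤s n<m) v with any? (λ i → ¬? (v i zero ℚ.≟ 0ℚ))
... | yes (k , a≢0) = linDep-pivot v k a≢0 (linDep n<m (pivotReduce v k))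
... | no  ¬pivot    = linDep-zeroColumn v
  (λ i → decidable-stable (v i zero ℚ.≟ 0ℚ) (λ a≢0 → ¬pivot (i , a≢0)))
  (linDep (m<n⇒m<1+n n<m) (λ i → v i ∘ suc))

triangular⇒linIndep : ∀ {m N} (t : Fin m → Pt N) (pivot : Fin m → Fin N) (h : Fin m → ℕ) →
  (∀ i → t i (pivot i) ≢ 0ℚ) → (∀ i j → j ≢ i → t j (pivot i) ≢ 0ℚ → h j < h i) → LinIndep t
triangular⇒linIndep t pivot h pivot≢0 lower c rel i = c≡0 (suc (h i)) i ≤-refl
  where
  c≡0 : ∀ k i → h i < k → c i ≡ 0ℚ
  c≡0 (suc k) i (s≤s hᵢ≤k) = x*y≡0⇒x≡0 (pivot≢0 i) (begin
    c i * t i (pivot i)    ≡⟨ Σℚ-single (λ j → c j * t j (pivot i)) i others≡0 ⟨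
    lincomb c t (pivot i)  ≡⟨ rel (pivot i) ⟩
    0ℚ                     ∎)
    where
    others≡0 : ∀ j → j ≢ i → c j * t j (pivot i) ≡ 0ℚ
    others≡0 j j≢i with t j (pivot i) ℚ.≟ 0ℚ
    ... | yes tⱼ≡0 = trans (cong (c j *_) tⱼ≡0) (ℚ.*-zeroʳ (c j))
    ... | no  tⱼ≢0 = trans (cong (_* t j (pivot i)) (c≡0 k j (<-≤-trans (lower i j j≢i tⱼ≢0) hᵢ≤k)))
                           (ℚ.*-zeroˡ (t j (pivot i)))

⟨⟩-cong : ∀ {N} {x y : Pt N} β → x ≋ y → ⟨ x , β ⟩ ≡ ⟨ y , β ⟩
⟨⟩-cong β x≋y = Σℚ-cong (λ k → cong (_* β k) (x≋y k))

⟨⟩-zero : ∀ {N} {x : Pt N} β → (∀ k → x k ≡ 0ℚ) → ⟨ x , β ⟩ ≡ 0ℚ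
⟨⟩-zero β x≡0 = Σℚ-zero (λ k → trans (cong (_* β k) (x≡0 k)) (ℚ.*-zeroˡ (β k)))

Σℚ-lincomb : ∀ {m N} (c : Fin m → ℚ) (p : Fin m → Pt N) →
  Σℚ (lincomb c p) ≡ Σℚ (λ i → c i * Σℚ (p i))
Σℚ-lincomb c p = begin
  Σℚ (λ k → Σℚ (λ i → c i * p i k))  ≡⟨ Σℚ-comm (λ k i → c i * p i k) ⟩
  Σℚ (λ i → Σℚ (λ k → c i * p i k))  ≡⟨ Σℚ-cong (λ i → *-distribˡ-Σℚ (c i) (p i)) ⟨
  Σℚ (λ i → c i * Σℚ (p i))          ∎

⟨lincomb⟩ : ∀ {m N} (c : Fin m → ℚ) (p : Fin m → Pt N) β →
  ⟨ lincomb c p , β ⟩ ≡ Σℚ (λ i → c i * ⟨ p i , β ⟩)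
⟨lincomb⟩ c p β = begin
  Σℚ (λ k → lincomb c p k * β k)        ≡⟨ Σℚ-cong (λ k → trans (*-distribʳ-Σℚ (β k) (λ i → c i * p i k))
                                              (Σℚ-cong λ i → ℚ.*-assoc (c i) (p i k) (β k))) ⟩
  Σℚ (lincomb c (λ i k → p i k * β k))  ≡⟨ Σℚ-lincomb c (λ i k → p i k * β k) ⟩
  Σℚ (λ i → c i * ⟨ p i , β ⟩)          ∎

linIndep⇒affIndep : ∀ {m N} {p : Fin m → Pt N} → LinIndep p → AffIndep p
linIndep⇒affIndep indep c _ = indep c

affIndep-cons : ∀ {m N} {p : Fin m → Pt N} {x β : Pt N} {b} →
  LinIndep p → (∀ i → ⟨ p i , β ⟩ ≡ b) → ⟨ x , β ⟩ ≢ b → AffIndep (x ∷ p)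
affIndep-cons {m} {p = p} {x} {β} {b} indep onLevel offLevel c Σc≡0 rel = c≡0
  where
  c₀ : ℚ
  c₀ = c zero
  c′ : Fin m → ℚ
  c′ = c ∘ suc
  X : ℚ
  X = ⟨ x , β ⟩

  value : c₀ * X + Σℚ c′ * b ≡ 0ℚ
  value = begin
    c₀ * X + Σℚ c′ * b                  ≡⟨ cong (c₀ * X +_) (*-distribʳ-Σℚ b c′) ⟩
    c₀ * X + Σℚ (λ i → c′ i * b)        ≡⟨ cong (c₀ * X +_) (Σℚ-cong λ i → cong (c′ i *_) (onLevel i)) ⟨
    Σℚ (λ i → c i * ⟨ (x ∷ p) i , β ⟩)  ≡⟨ ⟨lincomb⟩ c (x ∷ p) β ⟨
    ⟨ lincomb c (x ∷ p) , β ⟩           ≡⟨ ⟨⟩-zero β rel ⟩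
    0ℚ                                  ∎

  c₀≡0 : c₀ ≡ 0ℚ
  c₀≡0 = x*y≡0⇒x≡0 (offLevel ∘ ℚ-Group.x∙y⁻¹≈ε⇒x≈y X b) (begin
    c₀ * (X - b)                       ≡⟨ solve 4 (λ c₀ X b s → c₀ :* (X :- b) := (c₀ :* X :+ s :* b) :- b :* (c₀ :+ s))
                                              refl c₀ X b (Σℚ c′) ⟩
    (c₀ * X + Σℚ c′ * b) - b * Σℚ c    ≡⟨ cong₂ (λ u v → u - b * v) value Σc≡0 ⟩
    0ℚ - b * 0ℚ                        ≡⟨ solve 1 (λ b → con 0ℚ :- b :* con 0ℚ := con 0ℚ) refl b ⟩
    0ℚ                                 ∎)

  c′-rel : ∀ k → lincomb c′ p k ≡ 0ℚ
  c′-rel k = begin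
    lincomb c′ p k              ≡⟨ ℚ.+-identityˡ _ ⟨
    0ℚ + lincomb c′ p k         ≡⟨ cong (_+ lincomb c′ p k) (trans (cong (_* x k) c₀≡0) (ℚ.*-zeroˡ (x k))) ⟨
    c₀ * x k + lincomb c′ p k   ≡⟨ rel k ⟩
    0ℚ                          ∎

  c≡0 : ∀ i → c i ≡ 0ℚ
  c≡0 zero    = c₀≡0
  c≡0 (suc i) = indep c′ c′-rel i

zeroSum-lincomb≡0 : ∀ {m n} (c : Fin m → ℚ) (p : Fin m → Pt (suc n)) → (∀ i → Σℚ (p i) ≡ 0ℚ) →
  (∀ r → lincomb c p (suc r) ≡ 0ℚ) → ∀ k → lincomb c p k ≡ 0ℚ
zeroSum-lincomb≡0 c p Σp≡0 tail≡0 (suc r) = tail≡0 r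
zeroSum-lincomb≡0 c p Σp≡0 tail≡0 zero    = begin
  lincomb c p zero              ≡⟨ ℚ.+-identityʳ _ ⟨
  lincomb c p zero + 0ℚ         ≡⟨ cong (lincomb c p zero +_) (Σℚ-zero tail≡0) ⟨
  Σℚ (lincomb c p)              ≡⟨ Σℚ-lincomb c p ⟩
  Σℚ (λ i → c i * Σℚ (p i))     ≡⟨ Σℚ-zero (λ i → trans (cong (c i *_) (Σp≡0 i)) (ℚ.*-zeroʳ (c i))) ⟩
  0ℚ                            ∎

zeroSum⇒affDep : ∀ {n} (p : Fin (suc (suc n)) → Pt (suc n)) → (∀ i → Σℚ (p i) ≡ 0ℚ) → ¬ AffIndep p
zeroSum⇒affDep p Σp≡0 indep with linDep ≤-refl (λ i → 1ℚ ∷ (p i ∘ suc))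
... | c , (j , cⱼ≢0) , rel = cⱼ≢0 (indep c Σc≡0 (zeroSum-lincomb≡0 c p Σp≡0 (rel ∘ suc)) j)
  where
  Σc≡0 : Σℚ c ≡ 0ℚ
  Σc≡0 = trans (Σℚ-cong (λ i → sym (ℚ.*-identityʳ (c i)))) (rel zero)

levelSet⇒affDep : ∀ {n} (p : Fin (suc n) → Pt (suc n)) {β b} → (∀ i → Σℚ (p i) ≡ 0ℚ) →
  (∀ i → ⟨ p i , β ⟩ ≡ b) → b ≢ 0ℚ → ¬ AffIndep p
levelSet⇒affDep p {β} {b} Σp≡0 onLevel b≢0 indep with linDep ≤-refl (λ i → p i ∘ suc)
... | c , (j , cⱼ≢0) , rel = cⱼ≢0 (indep c Σc≡0 combination≡0 j)
  where
  combination≡0 : ∀ k → lincomb c p k ≡ 0ℚ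
  combination≡0 = zeroSum-lincomb≡0 c p Σp≡0 rel
  Σc≡0 : Σℚ c ≡ 0ℚ
  Σc≡0 = x*y≡0⇒x≡0 b≢0 (begin
    Σℚ c * b                      ≡⟨ *-distribʳ-Σℚ b c ⟩
    Σℚ (λ i → c i * b)            ≡⟨ Σℚ-cong (λ i → cong (c i *_) (onLevel i)) ⟨
    Σℚ (λ i → c i * ⟨ p i , β ⟩)  ≡⟨ ⟨lincomb⟩ c p β ⟨
    ⟨ lincomb c p , β ⟩           ≡⟨ ⟨⟩-zero β combination≡0 ⟩
    0ℚ                            ∎)

e-view : ∀ {N} (a x : Fin N) → (a ≡ x × e a x ≡ 1ℚ) ⊎ (a ≢ x × e a x ≡ 0ℚ)
e-view a x with a ≟ x
... | yes a≡x = inj₁ (a≡x , refl)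
... | no  a≢x = inj₂ (a≢x , refl)

e-diag : ∀ {N} (a : Fin N) → e a a ≡ 1ℚ
e-diag a with e-view a a
... | inj₁ (_ , eaa≡1)   = eaa≡1
... | inj₂ (a≢a , _)     = contradiction refl a≢a

e-offDiag : ∀ {N} {a x : Fin N} → a ≢ x → e a x ≡ 0ℚ
e-offDiag {a = a} {x} a≢x with e-view a x
... | inj₁ (a≡x , _)     = contradiction a≡x a≢x
... | inj₂ (_ , eax≡0)   = eax≡0

⟨e⟩ : ∀ {N} (a : Fin N) β → ⟨ e a , β ⟩ ≡ β a
⟨e⟩ a β = begin
  ⟨ e a , β ⟩   ≡⟨ Σℚ-single (λ k → e a k * β k) a
                      (λ k k≢a → trans (cong (_* β k) (e-offDiag (k≢a ∘ sym))) (ℚ.*-zeroˡ (β k))) ⟩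
  e a a * β a   ≡⟨ cong (_* β a) (e-diag a) ⟩
  1ℚ * β a      ≡⟨ ℚ.*-identityˡ (β a) ⟩
  β a           ∎

⟨⊖⟩ : ∀ {N} (x y β : Pt N) → ⟨ x ⊖ y , β ⟩ ≡ ⟨ x , β ⟩ - ⟨ y , β ⟩
⟨⊖⟩ x y β = begin
  ⟨ x ⊖ y , β ⟩                                     ≡⟨ Σℚ-cong term ⟩
  Σℚ (λ k → 1ℚ * (x k * β k) + - 1ℚ * (y k * β k))  ≡⟨ Σℚ-linear 1ℚ (- 1ℚ) (λ k → x k * β k) (λ k → y k * β k) ⟩
  1ℚ * ⟨ x , β ⟩ + - 1ℚ * ⟨ y , β ⟩                 ≡⟨ solve 2 (λ X Y → con 1ℚ :* X :+ con (- 1ℚ) :* Y := X :- Y)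
                                                          refl ⟨ x , β ⟩ ⟨ y , β ⟩ ⟩
  ⟨ x , β ⟩ - ⟨ y , β ⟩                             ∎
  where
  term : ∀ k → (x k - y k) * β k ≡ 1ℚ * (x k * β k) + - 1ℚ * (y k * β k)
  term k = solve 3 (λ x y β → (x :- y) :* β := con 1ℚ :* (x :* β) :+ con (- 1ℚ) :* (y :* β)) refl (x k) (y k) (β k)

⟨e⊖e⟩ : ∀ {N} (a b : Fin N) β → ⟨ e a ⊖ e b , β ⟩ ≡ β a - β b
⟨e⊖e⟩ a b β = trans (⟨⊖⟩ (e a) (e b) β) (cong₂ _-_ (⟨e⟩ a β) (⟨e⟩ b β))

Σℚ-e⊖e : ∀ {N} (a b : Fin N) → Σℚ (e a ⊖ e b) ≡ 0ℚ
Σℚ-e⊖e a b = begin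
  Σℚ (e a ⊖ e b)              ≡⟨ Σℚ-cong (λ k → ℚ.*-identityʳ ((e a ⊖ e b) k)) ⟨
  ⟨ e a ⊖ e b , (λ _ → 1ℚ) ⟩  ≡⟨ ⟨e⊖e⟩ a b (λ _ → 1ℚ) ⟩
  1ℚ - 1ℚ                     ≡⟨⟩
  0ℚ                          ∎

e⊖e-left : ∀ {N} {a b : Fin N} → a ≢ b → (e a ⊖ e b) a ≡ 1ℚ
e⊖e-left {a = a} a≢b = cong₂ _-_ (e-diag a) (e-offDiag (a≢b ∘ sym))

e⊖e-right : ∀ {N} {a b : Fin N} → a ≢ b → (e a ⊖ e b) b ≡ - 1ℚ
e⊖e-right {b = b} a≢b = cong₂ _-_ (e-offDiag a≢b) (e-diag b)

e⊖e≡1⇒ : ∀ {N} {a b x : Fin N} → (e a ⊖ e b) x ≡ 1ℚ → a ≡ x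
e⊖e≡1⇒ {a = a} {b} {x} eq with e-view a x | e-view b x
... | inj₁ (a≡x , _)   | _                = a≡x
... | inj₂ (_ , eax≡0) | inj₁ (_ , ebx≡1) = contradiction (trans (sym (cong₂ _-_ eax≡0 ebx≡1)) eq) λ ()
... | inj₂ (_ , eax≡0) | inj₂ (_ , ebx≡0) = contradiction (trans (sym (cong₂ _-_ eax≡0 ebx≡0)) eq) λ ()

e⊖e≡-1⇒ : ∀ {N} {a b x : Fin N} → (e a ⊖ e b) x ≡ - 1ℚ → b ≡ x
e⊖e≡-1⇒ {a = a} {b} {x} eq with e-view b x | e-view a x
... | inj₁ (b≡x , _)   | _                = b≡x
... | inj₂ (_ , ebx≡0) | inj₁ (_ , eax≡1) = contradiction (trans (sym (cong₂ _-_ eax≡1 ebx≡0)) eq) λ ()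
... | inj₂ (_ , ebx≡0) | inj₂ (_ , eax≡0) = contradiction (trans (sym (cong₂ _-_ eax≡0 ebx≡0)) eq) λ ()

e⊖e-support : ∀ {N} {a b x : Fin N} → (e a ⊖ e b) x ≢ 0ℚ → a ≡ x ⊎ b ≡ x
e⊖e-support {a = a} {b} {x} nonzero with e-view a x | e-view b x
... | inj₁ (a≡x , _)   | _                = inj₁ a≡x
... | inj₂ _           | inj₁ (b≡x , _)   = inj₂ b≡x
... | inj₂ (_ , eax≡0) | inj₂ (_ , ebx≡0) = contradiction (cong₂ _-_ eax≡0 ebx≡0) nonzero

e⊖e-injective : ∀ {N} {a b a′ b′ : Fin N} → a′ ≢ b′ → (e a ⊖ e b) ≋ (e a′ ⊖ e b′) →
  a ≡ a′ × b ≡ b′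
e⊖e-injective {a = a} {b} {a′} {b′} a′≢b′ eq =
    e⊖e≡1⇒ {b = b} (trans (eq a′) (e⊖e-left a′≢b′))
  , e⊖e≡-1⇒ {a = a} (trans (eq b′) (e⊖e-right a′≢b′))

least : ∀ {P : ℕ → Set} → Decidable P → ∀ m → P m → Σ ℕ λ k → P k × (∀ {i} → i < k → ¬ P i)
least P? m Pm with P? 0
... | yes P0 = 0 , P0 , λ ()
least P? zero    Pm | no ¬P0 = contradiction Pm ¬P0
least {P} P? (suc m) Pm | no ¬P0 with least (P? ∘ suc) m Pm
... | k , Pk , below = suc k , Pk , below′
  where
  below′ : ∀ {i} → i < suc k → ¬ P i
  below′ {zero}  _         = ¬P0
  below′ {suc i} (s≤s i<k) = below i<k

does≡true⇒ : ∀ {A : Set} (a? : Dec A) → does a? ≡ true → A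
does≡true⇒ (yes a) _ = a

subsetOf : ∀ {N} {P : Fin N → Set} → Decidable P → Subset N
subsetOf P? = tabulate (does ∘ P?)

∈-subsetOf : ∀ {N} {P : Fin N → Set} (P? : Decidable P) {v} → v ∈ subsetOf P? ⇔ P v
∈-subsetOf P? {v} = mk⇔
  (λ v∈P → does≡true⇒ (P? v) (trans (sym (lookup∘tabulate (does ∘ P?) v)) ([]=⇒lookup v∈P)))
  (λ Pv → lookup⇒[]= v _ (trans (lookup∘tabulate (does ∘ P?) v) (dec-true (P? v) Pv)))

Pair : ∀ {N} → Fin N → Fin N → Fin N → Fin N → Set
Pair a b i j = (i ≡ a × j ≡ b) ⊎ (i ≡ b × j ≡ a)

pair? : ∀ {N} (a b i j : Fin N) → Dec (Pair a b i j)
pair? a b i j = (i ≟ a ×-dec j ≟ b) ⊎-dec (i ≟ b ×-dec j ≟ a)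

module _ {N} {E : Fin N → Fin N → Bool} (E-sym : ∀ i j → T (E i j) → T (E j i))
         (B : Subgraph E) {a b : Fin N} (ab∈E : T (E a b)) where

  private
    H⁺ : Fin N → Fin N → Bool
    H⁺ i j = H B i j ∨ does (pair? a b i j)

    H⁺-view : ∀ {i j} → T (H⁺ i j) → T (H B i j) ⊎ Pair a b i j
    H⁺-view {i} {j} =
      Sum.map₂ (does≡true⇒ (pair? a b i j) ∘ Equivalence.to T-≡) ∘ Equivalence.to (T-∨ {H B i j})

    pair⇒H⁺ : ∀ {i j} → Pair a b i j → T (H⁺ i j)
    pair⇒H⁺ {i} {j} ab =
      Equivalence.from (T-∨ {H B i j}) (inj₂ (Equivalence.from T-≡ (dec-true (pair? a b i j) ab)))

    B⇒H⁺ : ∀ {i j} → T (H B i j) → T (H⁺ i j)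
    B⇒H⁺ {i} {j} = Equivalence.from (T-∨ {H B i j}) ∘ inj₁

    V⁺ : Fin N → Bool
    V⁺ i = V B i ∨ does (i ≟ a ⊎-dec i ≟ b)

    end⇒V⁺ : ∀ {i} → i ≡ a ⊎ i ≡ b → T (V⁺ i)
    end⇒V⁺ {i} end =
      Equivalence.from (T-∨ {V B i}) (inj₂ (Equivalence.from T-≡ (dec-true (i ≟ a ⊎-dec i ≟ b) end)))

    B⇒V⁺ : ∀ {i} → T (V B i) → T (V⁺ i)
    B⇒V⁺ {i} = Equivalence.from (T-∨ {V B i}) ∘ inj₁

  withEdge : Subgraph E
  withEdge = record
    { V    = V⁺
    ; H    = H⁺
    ; Hsym = λ i j → symmetric ∘ H⁺-view
    ; H⊆E  = λ i j → inE ∘ H⁺-view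
    ; ends = λ i j → endpoints ∘ H⁺-view
    }
    where
    symmetric : ∀ {i j} → T (H B i j) ⊎ Pair a b i j → T (H⁺ j i)
    symmetric (inj₁ ij∈B)                = B⇒H⁺ (Hsym B _ _ ij∈B)
    symmetric (inj₂ (inj₁ (i≡a , j≡b))) = pair⇒H⁺ (inj₂ (j≡b , i≡a))
    symmetric (inj₂ (inj₂ (i≡b , j≡a))) = pair⇒H⁺ (inj₁ (j≡a , i≡b))

    inE : ∀ {i j} → T (H B i j) ⊎ Pair a b i j → T (E i j)
    inE (inj₁ ij∈B)               = H⊆E B _ _ ij∈B
    inE (inj₂ (inj₁ (refl , refl))) = ab∈E
    inE (inj₂ (inj₂ (refl , refl))) = E-sym a b ab∈E

    endpoints : ∀ {i j} → T (H B i j) ⊎ Pair a b i j → T (V⁺ i) × T (V⁺ j)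
    endpoints (inj₁ ij∈B)                = Product.map B⇒V⁺ B⇒V⁺ (ends B _ _ ij∈B)
    endpoints (inj₂ (inj₁ (i≡a , j≡b))) = end⇒V⁺ (inj₁ i≡a) , end⇒V⁺ (inj₂ j≡b)
    endpoints (inj₂ (inj₂ (i≡b , j≡a))) = end⇒V⁺ (inj₂ i≡b) , end⇒V⁺ (inj₁ j≡a)

  ≤G-withEdge : B ≤G withEdge
  ≤G-withEdge = (λ _ → B⇒V⁺) , (λ _ _ → B⇒H⁺)

  withEdge-∋ : T (H withEdge a b)
  withEdge-∋ = pair⇒H⁺ (inj₁ (refl , refl))

  withEdge-bipartition : ∀ {c} → IsBipartition B c → c a ≢ c b → IsBipartition withEdge c
  withEdge-bipartition {c} c-bip ca≢cb i j = separated ∘ H⁺-view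
    where
    separated : T (H B i j) ⊎ Pair a b i j → c i ≢ c j
    separated (inj₁ ij∈B)                 = c-bip i j ij∈B
    separated (inj₂ (inj₁ (refl , refl))) = ca≢cb
    separated (inj₂ (inj₂ (refl , refl))) = ca≢cb ∘ sym

twist : ∀ {N} → (Fin N → Bool) → (Fin N → Bool) → Fin N → Bool
twist R c w = if R w then c w else not (c w)

twist-bipartition : ∀ {N} {E : Fin N → Fin N → Bool} {B : Subgraph E} {R c : Fin N → Bool} →
  (∀ u v → T (H B u v) → R u ≡ R v) → IsBipartition B c → IsBipartition B (twist R c)
twist-bipartition {R = R} invariant c-bip u v uv∈B with R u | R v | invariant u v uv∈B
... | true  | true  | _ = c-bip u v uv∈B
... | false | false | _ = c-bip u v uv∈B ∘ not-injective

twist-separates : ∀ {N} {R c : Fin N → Bool} {u v} → R u ≢ R v → c u ≡ c v → twist R c u ≢ twist R c v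
twist-separates {R = R} {u = u} {v} Ru≢Rv cu≡cv with R u | R v
... | true  | true  = contradiction refl Ru≢Rv
... | false | false = contradiction refl Ru≢Rv
... | true  | false = not-¬ cu≡cv
... | false | true  = not-¬ (sym cu≡cv) ∘ sym

walk-invariant : ∀ {N} {E : Fin N → Fin N → Bool} {A : Set} (R : Fin N → A) →
  (∀ u v → T (E u v) → R u ≡ R v) → ∀ {u v} → Walk E u v → R u ≡ R v
walk-invariant R invariant here              = refl
walk-invariant R invariant (step uk∈E walk) = trans (invariant _ _ uk∈E) (walk-invariant R invariant walk)

module MaximalBipartiteProperties {N} {E : Fin N → Fin N → Bool}
  (E-sym : ∀ i j → T (E i j) → T (E j i)) (connected : Connected E)
  (B : Subgraph E) (maximal : MaximalBipartite B) where

  separated⇒B-edge : ∀ {a b} → T (E a b) → ∀ c → IsBipartition B c → c a ≢ c b → T (H B a b)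
  separated⇒B-edge {a} {b} ab∈E c c-bip ca≢cb =
    proj₂ (proj₂ maximal B⁺ (c , withEdge-bipartition E-sym B ab∈E c-bip ca≢cb) (≤G-withEdge E-sym B ab∈E)) a b
      (withEdge-∋ E-sym B ab∈E)
    where
    B⁺ : Subgraph E
    B⁺ = withEdge E-sym B ab∈E

  B-Invariant : (Fin N → Bool) → Set
  B-Invariant R = ∀ u v → T (H B u v) → R u ≡ R v

  -- An edge of G between two classes of a B-invariant R could be added to B, after flipping the colours on one side.
  B-invariant⇒E-invariant : ∀ {R} → B-Invariant R → ∀ u v → T (E u v) → R u ≡ R v
  B-invariant⇒E-invariant {R} invariant u v uv∈E with R u Bool.≟ R v
  ... | yes Ru≡Rv = Ru≡Rv
  ... | no  Ru≢Rv = contradiction (invariant u v uv∈B) Ru≢Rv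
    where
    c : Fin N → Bool
    c = proj₁ (proj₁ maximal)
    c-bip : IsBipartition B c
    c-bip = proj₂ (proj₁ maximal)
    uv∈B : T (H B u v)
    uv∈B with c u Bool.≟ c v
    ... | no  cu≢cv = separated⇒B-edge uv∈E c c-bip cu≢cv
    ... | yes cu≡cv = separated⇒B-edge uv∈E (twist R c) (twist-bipartition {B = B} invariant c-bip)
                                (twist-separates {R = R} {c} Ru≢Rv cu≡cv)

  B-invariant⇒constant : ∀ {R} → B-Invariant R → ∀ u v → R u ≡ R v
  B-invariant⇒constant {R} invariant u v = walk-invariant R (B-invariant⇒E-invariant invariant) (connected u v)

  B-Closed : Subset N → Set
  B-Closed S = ∀ u w → u ∈ S → T (H B u w) → w ∈ S

  closed⇒full : ∀ S → B-Closed S → Nonempty S → ∀ v → v ∈ S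
  closed⇒full S closed (x , x∈S) v =
    does≡true⇒ (v ∈? S) (trans (B-invariant⇒constant invariant v x) (dec-true (x ∈? S) x∈S))
    where
    invariant : B-Invariant (λ u → does (u ∈? S))
    invariant u w uw∈B with u ∈? S | w ∈? S
    ... | yes _   | yes _   = refl
    ... | no  _   | no  _   = refl
    ... | yes u∈S | no  w∉S = contradiction (closed u w u∈S uw∈B) w∉S
    ... | no  u∉S | yes w∈S = contradiction (closed w u w∈S (Hsym B u w uw∈B)) u∉S

  B-spanning : ∀ {i j} → i ≢ j → ∃ λ k → T (H B i k)
  B-spanning {i} {j} i≢j with any? (λ k → T? (H B i k))
  ... | yes edge = edge
  ... | no  none = contradiction (sym (x∈⁅y⁆⇒x≡y i (closed⇒full ⁅ i ⁆ closed (i , x∈⁅x⁆ i) j))) i≢j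
    where
    closed : B-Closed ⁅ i ⁆
    closed u w u∈⁅i⁆ uw∈B rewrite x∈⁅y⁆⇒x≡y i u∈⁅i⁆ = contradiction (w , uw∈B) none

  module BreadthFirst (r : Fin N) where

    Reached : Subset N → Fin N → Set
    Reached S v = v ∈ S ⊎ ∃ λ u → u ∈ S × T (H B u v)

    reached? : ∀ S → Decidable (Reached S)
    reached? S v = v ∈? S ⊎-dec any? (λ u → u ∈? S ×-dec T? (H B u v))

    ball : ℕ → Subset N
    ball zero    = ⁅ r ⁆
    ball (suc k) = subsetOf (reached? (ball k))

    ∈-ball-suc : ∀ k {v} → v ∈ ball (suc k) ⇔ Reached (ball k) v
    ∈-ball-suc k = ∈-subsetOf (reached? (ball k))

    ball-⊆ : ∀ k → ball k ⊆ ball (suc k)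
    ball-⊆ k = Equivalence.from (∈-ball-suc k) ∘ inj₁

    root∈ball : ∀ k → r ∈ ball k
    root∈ball zero    = x∈⁅x⁆ r
    root∈ball (suc k) = ball-⊆ k (root∈ball k)

    ball-expands : ∀ k {v} → v ∉ ball k → ball k ⊂ ball (suc k)
    ball-expands k {v} v∉ball
      with any? (λ u → any? (λ w → u ∈? ball k ×-dec ¬? (w ∈? ball k) ×-dec T? (H B u w)))
    ... | yes (u , w , u∈ , w∉ , uw∈B) = ball-⊆ k , w , Equivalence.from (∈-ball-suc k) (inj₂ (u , u∈ , uw∈B)) , w∉
    ... | no  none = contradiction (closed⇒full (ball k) closed (r , root∈ball k) v) v∉ball
      where
      closed : B-Closed (ball k)
      closed u w u∈ uw∈B = decidable-stable (w ∈? ball k) (λ w∉ → none (u , w , u∈ , w∉ , uw∈B))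

    ball-size : ∀ k → (∀ v → v ∈ ball k) ⊎ suc k ≤ ∣ ball k ∣
    ball-size zero    = inj₂ (≤-reflexive (sym (∣⁅x⁆∣≡1 r)))
    ball-size (suc k) with all? (_∈? ball k) | ball-size k
    ... | yes full | _         = inj₁ (ball-⊆ k ∘ full)
    ... | no  ¬full | inj₁ full = contradiction full ¬full
    ... | no  ¬full | inj₂ size with ¬∀⟶∃¬ N _ (_∈? ball k) ¬full
    ...   | v , v∉ball = inj₂ (≤-trans (s≤s size) (p⊂q⇒∣p∣<∣q∣ (ball-expands k v∉ball)))

    ball-full : ∀ v → v ∈ ball N
    ball-full with ball-size N
    ... | inj₁ full = full
    ... | inj₂ size = contradiction (≤-trans size (∣p∣≤n (ball N))) (n≮n N)

    -- Opaque: unfolding the search during type checking is prohibitively expensive.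
    opaque
      depth : Fin N → ℕ
      depth v = proj₁ (least (λ k → v ∈? ball k) N (ball-full v))

      ∈-ball-depth : ∀ v → v ∈ ball (depth v)
      ∈-ball-depth v = proj₁ (proj₂ (least (λ k → v ∈? ball k) N (ball-full v)))

      ∉-ball-<depth : ∀ v {k} → k < depth v → v ∉ ball k
      ∉-ball-<depth v = proj₂ (proj₂ (least (λ k → v ∈? ball k) N (ball-full v)))

    depth-minimal : ∀ {v} k → v ∈ ball k → depth v ≤ k
    depth-minimal {v} k v∈ball = ≮⇒≥ (λ k<depth → ∉-ball-<depth v k<depth v∈ball)

    parent : ∀ w → w ≢ r → ∃ λ u → T (H B u w) × depth u < depth w
    parent w w≢r with depth w | ∈-ball-depth w | ∉-ball-<depth w
    ... | zero  | w∈⁅r⁆  | _ = contradiction (x∈⁅y⁆⇒x≡y r w∈⁅r⁆) w≢r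
    ... | suc k | w∈ball | shallower with Equivalence.to (∈-ball-suc k) w∈ball
    ...   | inj₁ w∈ballₖ              = contradiction w∈ballₖ (shallower ≤-refl)
    ...   | inj₂ (u , u∈ballₖ , uw∈B) = u , uw∈B , s≤s (depth-minimal k u∈ballₖ)

normal-gap-≥-1 : ∀ {N} (side : Fin N → Bool) a b → - 1ℚ ≤ℚ normalOf side a - normalOf side b
normal-gap-≥-1 side a b with side a | side b
... | true  | true  = toWitness {a? = - 1ℚ ℚ.≤? 0ℚ} _
... | true  | false = toWitness {a? = - 1ℚ ℚ.≤? 1ℚ} _
... | false | true  = ℚ.≤-refl
... | false | false = toWitness {a? = - 1ℚ ℚ.≤? 0ℚ} _

normal-gap≤-1⇒V₋V₊ : ∀ {N} (side : Fin N → Bool) a b →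
  normalOf side a - normalOf side b ≤ℚ - 1ℚ → side a ≡ false × side b ≡ true
normal-gap≤-1⇒V₋V₊ side a b gap≤-1 with side a | side b
... | false | true  = refl , refl
... | true  | true  = contradiction gap≤-1 (toWitnessFalse {a? = 0ℚ ℚ.≤? - 1ℚ} _)
... | true  | false = contradiction gap≤-1 (toWitnessFalse {a? = 1ℚ ℚ.≤? - 1ℚ} _)
... | false | false = contradiction gap≤-1 (toWitnessFalse {a? = 0ℚ ℚ.≤? - 1ℚ} _)

normal-gap-V₋V₊ : ∀ {N} (side : Fin N → Bool) {a b} → side a ≡ false → side b ≡ true →
  normalOf side a - normalOf side b ≡ - 1ℚ
normal-gap-V₋V₊ side a∈V₋ b∈V₊ rewrite a∈V₋ | b∈V₊ = refl

normal-gap-V₊V₋ : ∀ {N} (side : Fin N → Bool) {a b} → side a ≡ true → side b ≡ false →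
  normalOf side a - normalOf side b ≡ 1ℚ
normal-gap-V₊V₋ side a∈V₊ b∈V₋ rewrite a∈V₊ | b∈V₋ = refl

module MaximalBipartiteFacet {d} {E : Fin (suc (suc d)) → Fin (suc (suc d)) → Bool}
  (simple : IsSimpleGraph E) (connected : Connected E) (B : Subgraph E) (maximal : MaximalBipartite B)
  (side : Fin (suc (suc d)) → Bool) (bip : IsBipartition B side) where

  open MaximalBipartiteProperties (proj₁ simple) connected B maximal
  open BreadthFirst zero

  α : Pt (suc (suc d))
  α = normalOf side

  B-irreflexive : ∀ {a b} → T (H B a b) → a ≢ b
  B-irreflexive {a} ab∈B refl = proj₂ simple a (H⊆E B a a ab∈B)

  record Orientation (u w : Fin (suc (suc d))) : Set where
    field
      tail head : Fin (suc (suc d))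
      edge      : T (H B tail head)
      tail∈V₋   : side tail ≡ false
      head∈V₊   : side head ≡ true
      endpoints : Pair u w tail head

    arrow : Pt (suc (suc d))
    arrow = e tail ⊖ e head

    arrow∈F : FacetOf B side arrow
    arrow∈F = tail , head , edge , tail∈V₋ , head∈V₊ , λ _ → refl

    reverse : Pt (suc (suc d))
    reverse = e head ⊖ e tail

    reverse∈∇ : Nabla E reverse
    reverse∈∇ = tail , head , H⊆E B tail head edge , inj₂ (λ _ → refl)

    reverse-value : ⟨ reverse , α ⟩ ≡ 1ℚ
    reverse-value = trans (⟨e⊖e⟩ head tail α) (normal-gap-V₊V₋ side head∈V₊ tail∈V₋)

  open Orientation using (arrow; arrow∈F; reverse; reverse∈∇; reverse-value)

  arrow-support : ∀ {u w x} (o : Orientation u w) → arrow o x ≢ 0ℚ → u ≡ x ⊎ w ≡ x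
  arrow-support record { tail = s ; head = t ; endpoints = inj₁ (refl , refl) } =
    e⊖e-support {a = s} {t}
  arrow-support record { tail = s ; head = t ; endpoints = inj₂ (refl , refl) } =
    Sum.swap ∘ e⊖e-support {a = s} {t}

  arrow-w≢0 : ∀ {u w} (o : Orientation u w) → arrow o w ≢ 0ℚ
  arrow-w≢0 record { edge = edge ; endpoints = inj₁ (refl , refl) } eq =
    contradiction (trans (sym (e⊖e-right (B-irreflexive edge))) eq) λ ()
  arrow-w≢0 record { edge = edge ; endpoints = inj₂ (refl , refl) } eq =
    contradiction (trans (sym (e⊖e-left (B-irreflexive edge))) eq) λ ()

  -- Opaque for the same reason as depth.
  opaque
    orient : ∀ {u w} → T (H B u w) → Orientation u w
    orient {u} {w} uw∈B with side u in u-side | side w in w-side | bip u w uw∈B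
    ... | false | true  | _ = record
      { tail = u ; head = w ; edge = uw∈B ; tail∈V₋ = u-side ; head∈V₊ = w-side
      ; endpoints = inj₁ (refl , refl) }
    ... | true  | false | _ = record
      { tail = w ; head = u ; edge = Hsym B u w uw∈B ; tail∈V₋ = w-side ; head∈V₊ = u-side
      ; endpoints = inj₂ (refl , refl) }
    ... | true  | true  | different = contradiction refl different
    ... | false | false | different = contradiction refl different

  F-value : ∀ {x} → FacetOf B side x → ⟨ x , α ⟩ ≡ - 1ℚ
  F-value (a , b , _ , a∈V₋ , b∈V₊ , x≋ab) =
    trans (⟨⟩-cong α x≋ab) (trans (⟨e⊖e⟩ a b α) (normal-gap-V₋V₊ side a∈V₋ b∈V₊))

  F-sum : ∀ {x} → FacetOf B side x → Σℚ x ≡ 0ℚ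
  F-sum (a , b , _ , _ , _ , x≋ab) = trans (Σℚ-cong x≋ab) (Σℚ-e⊖e a b)

  F⊆∇ : ∀ {x} → FacetOf B side x → Nabla E x
  F⊆∇ (a , b , ab∈B , _ , _ , x≋ab) = a , b , H⊆E B a b ab∈B , inj₁ x≋ab

  ∇-sum : ∀ {x} → Nabla E x → Σℚ x ≡ 0ℚ
  ∇-sum (a , b , _ , inj₁ x≋ab) = trans (Σℚ-cong x≋ab) (Σℚ-e⊖e a b)
  ∇-sum (a , b , _ , inj₂ x≋ba) = trans (Σℚ-cong x≋ba) (Σℚ-e⊖e b a)

  ∇-value : ∀ {x} → Nabla E x → - 1ℚ ≤ℚ ⟨ x , α ⟩
  ∇-value (a , b , _ , inj₁ x≋ab) =
    subst (- 1ℚ ≤ℚ_) (sym (trans (⟨⟩-cong α x≋ab) (⟨e⊖e⟩ a b α))) (normal-gap-≥-1 side a b)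
  ∇-value (a , b , _ , inj₂ x≋ba) =
    subst (- 1ℚ ≤ℚ_) (sym (trans (⟨⟩-cong α x≋ba) (⟨e⊖e⟩ b a α))) (normal-gap-≥-1 side b a)

  -- Breadth-first spanning tree of B rooted at zero; its i-th arrow joins suc i to its parent.
  parentOf : Fin (suc d) → Fin (suc (suc d))
  parentOf i = proj₁ (parent (suc i) λ ())

  parent-edge : ∀ i → T (H B (parentOf i) (suc i))
  parent-edge i = proj₁ (proj₂ (parent (suc i) λ ()))

  parent-shallower : ∀ i → depth (parentOf i) < depth (suc i)
  parent-shallower i = proj₂ (proj₂ (parent (suc i) λ ()))

  treeEdge : ∀ i → Orientation (parentOf i) (suc i)
  treeEdge i = orient (parent-edge i)

  tree : Fin (suc d) → Pt (suc (suc d))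
  tree i = arrow (treeEdge i)

  tree-support : ∀ i j → tree j (suc i) ≢ 0ℚ → parentOf j ≡ suc i ⊎ suc j ≡ suc i
  tree-support i j = arrow-support (treeEdge j)

  -- Besides its own arrow, the vertex suc i only meets the arrows to its children, which are deeper.
  height : Fin (suc d) → ℕ
  height i = suc (suc d) ∸ depth (suc i)

  tree-linIndep : LinIndep tree
  tree-linIndep = triangular⇒linIndep tree suc height (arrow-w≢0 ∘ treeEdge) lower
    where
    lower : ∀ i j → j ≢ i → tree j (suc i) ≢ 0ℚ → height j < height i
    lower i j j≢i nonzero with tree-support i j nonzero
    ... | inj₂ sj≡si      = contradiction (suc-injective sj≡si) j≢i
    ... | inj₁ parent≡si  = ∸-monoʳ-<
      (subst (λ u → depth u < depth (suc j)) parent≡si (parent-shallower j))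
      (depth-minimal (suc (suc d)) (ball-full (suc j)))

  tree∈F : ∀ i → FacetOf B side (tree i)
  tree∈F i = arrow∈F (treeEdge i)

  minimal⇒F : ∀ {x a b} → T (E a b) → x ≋ (e a ⊖ e b) → ⟨ x , α ⟩ ≤ℚ - 1ℚ → FacetOf B side x
  minimal⇒F {x} {a} {b} ab∈E x≋ab x≤-1 =
    a , b , separated⇒B-edge ab∈E side bip sides-differ , a∈V₋ , b∈V₊ , x≋ab
    where
    sides : side a ≡ false × side b ≡ true
    sides = normal-gap≤-1⇒V₋V₊ side a b
      (subst (_≤ℚ - 1ℚ) (trans (⟨⟩-cong α x≋ab) (⟨e⊖e⟩ a b α)) x≤-1)
    a∈V₋ : side a ≡ false
    a∈V₋ = proj₁ sides
    b∈V₊ : side b ≡ true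
    b∈V₊ = proj₂ sides
    sides-differ : side a ≢ side b
    sides-differ a≡b = contradiction (trans (sym a∈V₋) (trans a≡b b∈V₊)) λ ()

  minimiser≤-1 : ∀ {x} → (∀ y → Nabla E y → ⟨ x , α ⟩ ≤ℚ ⟨ y , α ⟩) → ⟨ x , α ⟩ ≤ℚ - 1ℚ
  minimiser≤-1 {x} minimal =
    subst (⟨ x , α ⟩ ≤ℚ_) (F-value (tree∈F zero)) (minimal (tree zero) (F⊆∇ (tree∈F zero)))

  innerNormal : IsInnerNormal (Nabla E) (FacetOf B side) α
  innerNormal x = mk⇔ to from
    where
    to : FacetOf B side x → Nabla E x × (∀ y → Nabla E y → ⟨ x , α ⟩ ≤ℚ ⟨ y , α ⟩)
    to x∈F = F⊆∇ x∈F , λ y y∈∇ → subst (_≤ℚ ⟨ y , α ⟩) (sym (F-value x∈F)) (∇-value y∈∇)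

    from : Nabla E x × (∀ y → Nabla E y → ⟨ x , α ⟩ ≤ℚ ⟨ y , α ⟩) → FacetOf B side x
    from ((a , b , ab∈E , inj₁ x≋ab) , minimal) = minimal⇒F ab∈E x≋ab (minimiser≤-1 {x} minimal)
    from ((a , b , ab∈E , inj₂ x≋ba) , minimal) =
      minimal⇒F (proj₁ simple a b ab∈E) x≋ba (minimiser≤-1 {x} minimal)

  ∇-dimension : AffDim (Nabla E) (suc d)
  ∇-dimension =
      (reversed ∷ tree , points∈∇ , affIndep-cons {p = tree} {β = α} tree-linIndep (F-value ∘ tree∈F) off-level)
    , λ p p∈∇ → zeroSum⇒affDep p (∇-sum ∘ p∈∇)
    where
    reversed : Pt (suc (suc d))
    reversed = reverse (treeEdge zero)

    points∈∇ : ∀ i → Nabla E ((reversed ∷ tree) i)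
    points∈∇ zero    = reverse∈∇ (treeEdge zero)
    points∈∇ (suc i) = F⊆∇ (tree∈F i)

    off-level : ⟨ reversed , α ⟩ ≢ - 1ℚ
    off-level 1≡-1 = contradiction (trans (sym (reverse-value (treeEdge zero))) 1≡-1) λ ()

  F-dimension : AffDim (FacetOf B side) d
  F-dimension = (tree , tree∈F , linIndep⇒affIndep {p = tree} tree-linIndep)
    , λ p p∈F → levelSet⇒affDep p {α} (F-sum ∘ p∈F) (F-value ∘ p∈F) λ ()

  diEdge : ∀ i j → DiEdge (FacetOf B side) i j ⇔ (T (H B i j) × side i ≡ false × side j ≡ true)
  diEdge i j = mk⇔ to (λ (ij∈B , i∈V₋ , j∈V₊) → i , j , ij∈B , i∈V₋ , j∈V₊ , λ _ → refl)
    where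
    to : DiEdge (FacetOf B side) i j → T (H B i j) × side i ≡ false × side j ≡ true
    to (a , b , ab∈B , a∈V₋ , b∈V₊ , ij≋ab) with e⊖e-injective {a = i} {j} (B-irreflexive ab∈B) ij≋ab
    ... | refl , refl = ab∈B , a∈V₋ , b∈V₊

  diVertex : ∀ i → DiVertex (FacetOf B side) i ⇔ T (V B i)
  diVertex i = mk⇔ to from
    where
    to : DiVertex (FacetOf B side) i → T (V B i)
    to (k , inj₁ ik∈F) = proj₁ (ends B i k (proj₁ (Equivalence.to (diEdge i k) ik∈F)))
    to (k , inj₂ ki∈F) = proj₂ (ends B k i (proj₁ (Equivalence.to (diEdge k i) ki∈F)))

    from : T (V B i) → DiVertex (FacetOf B side) i
    from _ with B-spanning (punchInᵢ≢i i zero ∘ sym)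
    ... | k , ik∈B with orient ik∈B
    ...   | record { edge = edge ; tail∈V₋ = t∈V₋ ; head∈V₊ = h∈V₊ ; endpoints = inj₁ (refl , refl) } =
      k , inj₁ (Equivalence.from (diEdge i k) (edge , t∈V₋ , h∈V₊))
    ...   | record { edge = edge ; tail∈V₋ = t∈V₋ ; head∈V₊ = h∈V₊ ; endpoints = inj₂ (refl , refl) } =
      k , inj₂ (Equivalence.from (diEdge k i) (edge , t∈V₋ , h∈V₊))

mainTheorem3 : (N : ℕ) (E : Fin N → Fin N → Bool) →
    IsSimpleGraph E → Connected E → HasEdge E →
    (B : Subgraph E) → MaximalBipartite B →
    (side : Fin N → Bool) → IsBipartition B side →
    IsFacet (Nabla E) (FacetOf B side) ×
    IsInnerNormal (Nabla E) (FacetOf B side) (normalOf side) ×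
    (∀ i j → DiEdge (FacetOf B side) i j ⇔ (T (H B i j) × side i ≡ false × side j ≡ true)) ×
    (∀ i → DiVertex (FacetOf B side) i ⇔ T (V B i))
mainTheorem3 zero          E _             _         (() , _)
mainTheorem3 (suc zero)    E (_ , irrefl)  _         (zero , zero , 00∈E) = contradiction 00∈E (irrefl zero)
mainTheorem3 (suc (suc d)) E simple connected _ B maximal side bip =
  ((normalOf side , innerNormal) , d , ∇-dimension , F-dimension) , innerNormal , diEdge , diVertex
  where open MaximalBipartiteFacet simple connected B maximal side bip
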